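{- Fix an unordered pair $P$ of colors and let $c$ be one of the six varieties having $P$ as an opposite pair. Then $c$ shares no corner triple with its mirror image $c^*$, and $c$ shares exactly two corner triples with each of the other four varieties having $P$ as an opposite pair; moreover these four pairs of shared corner triples are pairwise distinct (so they account for eight distinct corner triples of $c$).
   Context: Fix a palette of six colors. A colored cube is a unit cube each face painted one color, all six colors appearing. Varieties are colored cubes up to rigid rotation; $c^*$ denotes the mirror image (reflection) of $c$. An opposite pair is the unordered pair of colors on two opposite faces. A corner triple of a cube is the triple of colors on the three faces meeting at a vertex, read clockwise around the vertex, considered up to cyclic permutation (so $(2,3,6)\sim(6,2,3)\not\sim(6,3,2)$); each cube has eight corner triples. -}

module Defs where

open import Data.Fin using (Fin; zero; suc)
open import Data.List using (List; []; _∷_)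
open import Data.Product using (_×_; _,_; ∃; ∃-syntax)
open import Data.Sum using (_⊎_)
open import Relation.Binary.PropositionalEquality using (_≡_; refl; cong)
open import Relation.Nullary using (¬_)
open import Function.Definitions using (Injective)

Color : Set
Color = Fin 6

-- Faces of the unit cube, labelled by outward normals:
-- 0 = +x, 1 = -x, 2 = +y, 3 = -y, 4 = +z, 5 = -z.
-- Opposite faces: (0,1), (2,3), (4,5).
Face : Set
Face = Fin 6

-- A colored cube: each face painted one color, all six colors appearing
-- (an injective map Fin 6 → Fin 6, i.e. a bijection).
record Cube : Set where
  constructor mkCube
  field
    col : Face → Color
    col-inj : Injective _≡_ _≡_ col
open Cube public

-- Quarter turns (as permutations of face positions).
-- rx: quarter turn about the x-axis (+y ↦ +z ↦ -y ↦ -z ↦ +y).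
rx : Face → Face
rx zero = zero
rx (suc zero) = suc zero
rx (suc (suc zero)) = suc (suc (suc (suc zero)))
rx (suc (suc (suc zero))) = suc (suc (suc (suc (suc zero))))
rx (suc (suc (suc (suc zero)))) = suc (suc (suc zero))
rx (suc (suc (suc (suc (suc zero))))) = suc (suc zero)

-- ry: quarter turn about the y-axis (+z ↦ +x ↦ -z ↦ -x ↦ +z).
ry : Face → Face
ry zero = suc (suc (suc (suc (suc zero))))
ry (suc zero) = suc (suc (suc (suc zero)))
ry (suc (suc zero)) = suc (suc zero)
ry (suc (suc (suc zero))) = suc (suc (suc zero))
ry (suc (suc (suc (suc zero)))) = zero
ry (suc (suc (suc (suc (suc zero))))) = suc zero

-- The rotation group of the cube is generated by rx and ry;
-- a rotation is a word in these generators.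
data Gen : Set where
  gx gy : Gen

gen : Gen → Face → Face
gen gx = rx
gen gy = ry

Rotation : Set
Rotation = List Gen

act : Rotation → Face → Face
act [] f = f
act (g ∷ w) f = gen g (act w f)

SameVariety : Cube → Cube → Set
SameVariety c d = ∃[ w ] (∀ (f : Face) → col d f ≡ col c (act w f))

refl-x : Face → Face
refl-x zero = suc zero
refl-x (suc zero) = zero
refl-x (suc f) = suc f

refl-x-invol : ∀ f → refl-x (refl-x f) ≡ f
refl-x-invol zero = refl
refl-x-invol (suc zero) = refl
refl-x-invol (suc (suc f)) = refl

refl-x-inj : ∀ {f g} → refl-x f ≡ refl-x g → f ≡ g
refl-x-inj {f} {g} e with refl-x-invol f | refl-x-invol g | cong refl-x e
... | p | q | r rewrite p | q = r

mirror : Cube → Cube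
mirror c = mkCube (λ f → col c (refl-x f)) (λ e → refl-x-inj (col-inj c e))

oppFaces : Fin 3 → Face × Face
oppFaces zero = zero , suc zero
oppFaces (suc zero) = suc (suc zero) , suc (suc (suc zero))
oppFaces (suc (suc zero)) = suc (suc (suc (suc zero))) , suc (suc (suc (suc (suc zero))))

HasOppositePair : Cube → Color → Color → Set
HasOppositePair c a b = ∃[ i ]
  ( (col c (Data.Product.proj₁ (oppFaces i)) ≡ a × col c (Data.Product.proj₂ (oppFaces i)) ≡ b)
  ⊎ (col c (Data.Product.proj₁ (oppFaces i)) ≡ b × col c (Data.Product.proj₂ (oppFaces i)) ≡ a))

-- The eight vertices, each given by its three faces listed clockwise as seen
-- from outside the cube (right-handed coordinates).
Vertex : Set
Vertex = Fin 8

vertexFaces : Vertex → Face × Face × Face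
vertexFaces zero = zero , suc (suc (suc (suc zero))) , suc (suc zero)
vertexFaces (suc zero) = zero , suc (suc zero) , suc (suc (suc (suc (suc zero))))
vertexFaces (suc (suc zero)) = zero , suc (suc (suc zero)) , suc (suc (suc (suc zero)))
vertexFaces (suc (suc (suc zero))) = zero , suc (suc (suc (suc (suc zero)))) , suc (suc (suc zero))
vertexFaces (suc (suc (suc (suc zero)))) = suc zero , suc (suc zero) , suc (suc (suc (suc zero)))
vertexFaces (suc (suc (suc (suc (suc zero))))) = suc zero , suc (suc (suc (suc (suc zero)))) , suc (suc zero)
vertexFaces (suc (suc (suc (suc (suc (suc zero)))))) = suc zero , suc (suc (suc (suc zero))) , suc (suc (suc zero))
vertexFaces (suc (suc (suc (suc (suc (suc (suc zero))))))) = suc zero , suc (suc (suc zero)) , suc (suc (suc (suc (suc zero))))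

Triple : Set
Triple = Color × Color × Color

-- Equality of corner triples: up to cyclic permutation.
_~_ : Triple → Triple → Set
(x , y , z) ~ t = t ≡ (x , y , z) ⊎ t ≡ (y , z , x) ⊎ t ≡ (z , x , y)

corner : Cube → Vertex → Triple
corner c v with vertexFaces v
... | (f , g , h) = col c f , col c g , col c h

SharedAt : Cube → Cube → Vertex → Set
SharedAt c d v = ∃[ u ] (corner c v ~ corner d u)

ShareSome : Cube → Cube → Set
ShareSome c d = ∃[ v ] SharedAt c d v

-- A predicate on vertices holds at exactly two vertices.
-- (The eight corner triples of a cube are pairwise distinct, so counting
-- vertices of c equals counting corner triples of c.)
ExactlyTwo : (Vertex → Set) → Set
ExactlyTwo P = ∃[ v₁ ] ∃[ v₂ ] (¬ v₁ ≡ v₂ × P v₁ × P v₂ × (∀ v → P v → v ≡ v₁ ⊎ v ≡ v₂))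

module Submission where

-- Fix a cube c.  Because c uses every colour once, any other cube d is c with
-- its faces relabelled: d = c ∘ π for a unique permutation π of the faces (the
-- position of d relative to c).  In these terms
--   * d shares c's corner triple at v  iff  π carries some oriented corner onto
--     the oriented corner v (CornerImage π v);
--   * d is a rotation of d′ iff their positions lie in the same right coset
--     π·Rot of the rotation group; c itself has position id, c* has refl-x.
-- CornerImage is constant on right cosets, so only the coset of π matters.
-- If d has the opposite pair {a,b} of c, precomposing π with a rotation makes
-- it send the axis ±x onto the axis of c carrying a and b; there are 144 such
-- permutations, and a finite computation shows that each lies in the coset of
-- id, of refl-x, or of one of four representatives κ x t.  A second
-- computation shows that refl-x hits no oriented corner, that each κ x t hits
-- exactly two, and that distinct representatives hit disjoint sets of corners.

open import Defs
open import Data.Fin using (Fin; suc; _≟_; punchOut)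
open import Data.Fin.Patterns using (0F; 1F; 2F; 3F; 4F; 5F)
open import Data.Fin.Properties using (any?; all?; pigeonhole; punchOut-injective; <⇒≢)
import Data.Nat as ℕ
open import Data.Nat.Properties using (n<1+n)
open import Data.List using ([]; _∷_; _++_)
open import Data.Vec using (lookup) renaming ([] to []ᵛ; _∷_ to _∷ᵛ_)
open import Data.Product using (_×_; _,_; ∃; ∃-syntax; proj₁; proj₂)
import Data.Product.Properties as Product
open import Data.Sum using (_⊎_; inj₁; inj₂)
open import Data.Empty using (⊥-elim)
open import Relation.Binary.PropositionalEquality
  using (_≡_; refl; sym; trans; cong; subst₂; module ≡-Reasoning)
open import Relation.Nullary using (¬_; Dec; yes; no)
open import Relation.Nullary.Decidable using (_×-dec_; _⊎-dec_; _→-dec_; ¬?; from-yes)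
open import Function.Base using (_∘_)
open import Function.Definitions using (Injective)

Relabelling : Set
Relabelling = Face → Face

-- An injective endomap of a finite set is onto: if f missed y, punching y out
-- of its values would inject Fin (suc n) into Fin n (pigeonhole principle).
injective⇒surjective : ∀ {n} (f : Fin n → Fin n) → Injective _≡_ _≡_ f →
                       ∀ y → ∃[ x ] f x ≡ y
injective⇒surjective {ℕ.suc n} f f-inj y with any? (λ x → f x ≟ y)
... | yes hit = hit
... | no miss =
  let i , j , i<j , same = pigeonhole (n<1+n n) (λ x → punchOut (y≢f x))
  in ⊥-elim (<⇒≢ i<j (f-inj (punchOut-injective (y≢f i) (y≢f j) same)))
  where
  y≢f : ∀ x → ¬ y ≡ f x
  y≢f x e = miss (x , sym e)

mapTriple : Relabelling → Triple → Triple
mapTriple π (x , y , z) = π x , π y , π z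

mapTriple-cong : ∀ {φ ψ : Relabelling} → (∀ f → φ f ≡ ψ f) → ∀ t → mapTriple φ t ≡ mapTriple ψ t
mapTriple-cong e (x , y , z) rewrite e x | e y | e z = refl

mapTriple-injective : ∀ {π : Relabelling} → Injective _≡_ _≡_ π →
                      ∀ {s t} → mapTriple π s ≡ mapTriple π t → s ≡ t
mapTriple-injective π-inj {x , y , z} {x′ , y′ , z′} e
  with π-inj (cong proj₁ e) | π-inj (cong (proj₁ ∘ proj₂) e) | π-inj (cong (proj₂ ∘ proj₂) e)
... | refl | refl | refl = refl

~-trans : ∀ {s t u : Triple} → s ~ t → t ~ u → s ~ u
~-trans (inj₁ refl) q = q
~-trans (inj₂ (inj₁ refl)) (inj₁ refl) = inj₂ (inj₁ refl)
~-trans (inj₂ (inj₁ refl)) (inj₂ (inj₁ refl)) = inj₂ (inj₂ refl)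
~-trans (inj₂ (inj₁ refl)) (inj₂ (inj₂ refl)) = inj₁ refl
~-trans (inj₂ (inj₂ refl)) (inj₁ refl) = inj₂ (inj₂ refl)
~-trans (inj₂ (inj₂ refl)) (inj₂ (inj₁ refl)) = inj₁ refl
~-trans (inj₂ (inj₂ refl)) (inj₂ (inj₂ refl)) = inj₂ (inj₁ refl)

~-map : ∀ (π : Relabelling) {s t} → s ~ t → mapTriple π s ~ mapTriple π t
~-map π (inj₁ e) = inj₁ (cong (mapTriple π) e)
~-map π (inj₂ (inj₁ e)) = inj₂ (inj₁ (cong (mapTriple π) e))
~-map π (inj₂ (inj₂ e)) = inj₂ (inj₂ (cong (mapTriple π) e))

~-cancel : ∀ {π : Relabelling} → Injective _≡_ _≡_ π →
           ∀ {s t} → mapTriple π s ~ mapTriple π t → s ~ t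
~-cancel π-inj (inj₁ e) = inj₁ (mapTriple-injective π-inj e)
~-cancel π-inj (inj₂ (inj₁ e)) = inj₂ (inj₁ (mapTriple-injective π-inj e))
~-cancel π-inj (inj₂ (inj₂ e)) = inj₂ (inj₂ (mapTriple-injective π-inj e))

_~?_ : (s t : Triple) → Dec (s ~ t)
(x , y , z) ~? t = (t ≟³ (x , y , z)) ⊎-dec (t ≟³ (y , z , x)) ⊎-dec (t ≟³ (z , x , y))
  where
  _≟³_ : (s t : Triple) → Dec (s ≡ t)
  _≟³_ = Product.≡-dec _≟_ (Product.≡-dec _≟_ _≟_)

CornerImage : Relabelling → Vertex → Set
CornerImage π v = ∃[ u ] (vertexFaces v ~ mapTriple π (vertexFaces u))

cornerImage? : ∀ π v → Dec (CornerImage π v)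
cornerImage? π v = any? λ u → vertexFaces v ~? mapTriple π (vertexFaces u)

corner-faces : ∀ c v → corner c v ≡ mapTriple (col c) (vertexFaces v)
corner-faces c 0F = refl
corner-faces c 1F = refl
corner-faces c 2F = refl
corner-faces c 3F = refl
corner-faces c (suc 3F) = refl
corner-faces c (suc 4F) = refl
corner-faces c (suc 5F) = refl
corner-faces c (suc (suc 5F)) = refl

shared⇔cornerImage : ∀ {c d π} → (∀ f → col d f ≡ col c (π f)) → ∀ v →
                     (SharedAt c d v → CornerImage π v) × (CornerImage π v → SharedAt c d v)
shared⇔cornerImage {c} {d} {π} d≡cπ v =
  (λ { (u , h) → u , ~-cancel (col-inj c) (subst₂ _~_ (corner-faces c v) (corner-d u) h) }) ,
  (λ { (u , h) → u , subst₂ _~_ (sym (corner-faces c v)) (sym (corner-d u)) (~-map (col c) h) })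
  where
  corner-d : ∀ u → corner d u ≡ mapTriple (col c) (mapTriple π (vertexFaces u))
  corner-d u = trans (corner-faces d u) (mapTriple-cong d≡cπ (vertexFaces u))

exactlyTwo-transport : ∀ {P Q : Vertex → Set} → (∀ v → P v → Q v) → (∀ v → Q v → P v) →
                       ExactlyTwo P → ExactlyTwo Q
exactlyTwo-transport P⇒Q Q⇒P (v₁ , v₂ , v₁≢v₂ , p₁ , p₂ , only) =
  v₁ , v₂ , v₁≢v₂ , P⇒Q v₁ p₁ , P⇒Q v₂ p₂ , λ v q → only v (Q⇒P v q)

act-++ : ∀ w w′ f → act (w ++ w′) f ≡ act w (act w′ f)
act-++ [] w′ f = refl
act-++ (g ∷ w) w′ f = cong (gen g) (act-++ w w′ f)

gen-order-4 : ∀ g f → gen g (gen g (gen g (gen g f))) ≡ f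
gen-order-4 gx = from-yes (all? λ f → rx (rx (rx (rx f))) ≟ f)
gen-order-4 gy = from-yes (all? λ f → ry (ry (ry (ry f))) ≟ f)

-- A word for the inverse rotation: each generator is inverted by its cube.
inverse : Rotation → Rotation
inverse [] = []
inverse (g ∷ w) = inverse w ++ (g ∷ g ∷ g ∷ [])

act-inverse : ∀ w f → act w (act (inverse w) f) ≡ f
act-inverse [] f = refl
act-inverse (g ∷ w) f = begin
  gen g (act w (act (inverse w ++ g ∷ g ∷ g ∷ []) f))
    ≡⟨ cong (gen g ∘ act w) (act-++ (inverse w) _ f) ⟩
  gen g (act w (act (inverse w) (act (g ∷ g ∷ g ∷ []) f)))
    ≡⟨ cong (gen g) (act-inverse w _) ⟩
  gen g (gen g (gen g (gen g f)))
    ≡⟨ gen-order-4 g f ⟩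
  f  ∎
  where open ≡-Reasoning

gen-injective : ∀ g → Injective _≡_ _≡_ (gen g)
gen-injective g {f} {f′} e =
  trans (sym (gen-order-4 g f)) (trans (cong (gen g ∘ gen g ∘ gen g) e) (gen-order-4 g f′))

act-injective : ∀ w → Injective _≡_ _≡_ (act w)
act-injective [] e = e
act-injective (g ∷ w) e = act-injective w (gen-injective g e)

gen-corner : ∀ g u → ∃[ u′ ] (mapTriple (gen g) (vertexFaces u) ~ vertexFaces u′)
gen-corner gx = from-yes (all? λ u → any? λ u′ → mapTriple rx (vertexFaces u) ~? vertexFaces u′)
gen-corner gy = from-yes (all? λ u → any? λ u′ → mapTriple ry (vertexFaces u) ~? vertexFaces u′)

act-corner : ∀ w u → ∃[ u′ ] (mapTriple (act w) (vertexFaces u) ~ vertexFaces u′)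
act-corner [] u = u , inj₁ refl
act-corner (g ∷ w) u with act-corner w u
... | u₁ , h₁ with gen-corner g u₁
...   | u₂ , h₂ = u₂ , ~-trans (~-map (gen g) h₁) h₂

record InCoset (σ π : Relabelling) : Set where
  constructor coset
  field
    word : Rotation
    factors : ∀ f → π f ≡ σ (act word f)

coset-sym : ∀ {σ π} → InCoset σ π → InCoset π σ
coset-sym {σ} (coset w e) =
  coset (inverse w) λ f → trans (cong σ (sym (act-inverse w f))) (sym (e _))

coset-trans : ∀ {σ τ π} → InCoset σ τ → InCoset τ π → InCoset σ π
coset-trans {σ} (coset w₁ e₁) (coset w₂ e₂) =
  coset (w₁ ++ w₂) λ f → trans (e₂ f) (trans (e₁ _) (cong σ (sym (act-++ w₁ w₂ f))))

coset-cornerImage : ∀ {σ π} → InCoset σ π → ∀ v → CornerImage π v → CornerImage σ v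
coset-cornerImage {σ} (coset w e) v (u , h) with act-corner w u
... | u′ , k = u′ , ~-trans h (subst₂ _~_ (sym (mapTriple-cong e (vertexFaces u))) refl (~-map σ k))

coset⇒sameVariety : ∀ {c d e} {σ π : Relabelling} →
                    (∀ f → col d f ≡ col c (σ f)) → (∀ f → col e f ≡ col c (π f)) →
                    InCoset σ π → SameVariety d e
coset⇒sameVariety {c} d≡cσ e≡cπ (coset w e) =
  w , λ f → trans (e≡cπ f) (trans (cong (col c) (e f)) (sym (d≡cσ _)))

opp : Face → Face
opp = lookup (1F ∷ᵛ 0F ∷ᵛ 3F ∷ᵛ 2F ∷ᵛ 5F ∷ᵛ 4F ∷ᵛ []ᵛ)

oppositeFace : ∀ {d a b} → HasOppositePair d a b → ∃[ y ] (col d y ≡ a × col d (opp y) ≡ b)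
oppositeFace (0F , inj₁ (e₁ , e₂)) = 0F , e₁ , e₂
oppositeFace (0F , inj₂ (e₁ , e₂)) = 1F , e₂ , e₁
oppositeFace (1F , inj₁ (e₁ , e₂)) = 2F , e₁ , e₂
oppositeFace (1F , inj₂ (e₁ , e₂)) = 3F , e₂ , e₁
oppositeFace (2F , inj₁ (e₁ , e₂)) = 4F , e₁ , e₂
oppositeFace (2F , inj₂ (e₁ , e₂)) = 5F , e₂ , e₁

axisOf : ∀ {d a b} → HasOppositePair d a b → Face
axisOf {d} h = proj₁ (oppositeFace {d} h)

toward : Face → Rotation
toward 0F = []
toward 1F = gy ∷ gy ∷ []
toward 2F = gx ∷ gy ∷ []
toward 3F = gx ∷ gx ∷ gx ∷ gy ∷ []
toward 4F = gx ∷ gx ∷ gy ∷ []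
toward 5F = gy ∷ []

toward-axis : ∀ y → act (toward y) 0F ≡ y × act (toward y) 1F ≡ opp y
toward-axis = from-yes (all? λ y → (act (toward y) 0F ≟ y) ×-dec (act (toward y) 1F ≟ opp y))

-- The 24 rotations: s quarter turns about the x-axis followed by toward y.
rotation : Face → Fin 4 → Rotation
rotation y 0F = toward y
rotation y 1F = toward y ++ gx ∷ []
rotation y 2F = toward y ++ gx ∷ gx ∷ []
rotation y 3F = toward y ++ gx ∷ gx ∷ gx ∷ []

InCoset₂₄ : Relabelling → Relabelling → Set
InCoset₂₄ σ π = ∃[ y ] ∃[ s ] (∀ f → π f ≡ σ (act (rotation y s) f))

inCoset₂₄? : ∀ σ π → Dec (InCoset₂₄ σ π)
inCoset₂₄? σ π = any? λ y → any? λ s → all? λ f → π f ≟ σ (act (rotation y s) f)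

-- Representatives of the four cosets, among the relabellings fixing ±x, that
-- are neither rotations nor reflections: they fix +y and permute -y,+z,-z.
representative : Fin 4 → Relabelling
representative 0F = lookup (0F ∷ᵛ 1F ∷ᵛ 2F ∷ᵛ 4F ∷ᵛ 3F ∷ᵛ 5F ∷ᵛ []ᵛ)
representative 1F = lookup (0F ∷ᵛ 1F ∷ᵛ 2F ∷ᵛ 4F ∷ᵛ 5F ∷ᵛ 3F ∷ᵛ []ᵛ)
representative 2F = lookup (0F ∷ᵛ 1F ∷ᵛ 2F ∷ᵛ 5F ∷ᵛ 3F ∷ᵛ 4F ∷ᵛ []ᵛ)
representative 3F = lookup (0F ∷ᵛ 1F ∷ᵛ 2F ∷ᵛ 5F ∷ᵛ 4F ∷ᵛ 3F ∷ᵛ []ᵛ)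

κ : Face → Fin 4 → Relabelling
κ x t f = act (toward x) (representative t f)

Classification : (Relabelling → Relabelling → Set) → Face → Relabelling → Set
Classification R x π = R (λ f → f) π ⊎ R refl-x π ⊎ ∃[ t ] R (κ x t) π

map-classification : ∀ {R R′ : Relabelling → Relabelling → Set} {x π π′} →
                     (∀ {σ} → R σ π → R′ σ π′) → Classification R x π → Classification R′ x π′
map-classification f (inj₁ h) = inj₁ (f h)
map-classification f (inj₂ (inj₁ h)) = inj₂ (inj₁ (f h))
map-classification f (inj₂ (inj₂ (t , h))) = inj₂ (inj₂ (t , f h))

axial : Face → Face → Face → Face → Face → Relabelling
axial x a b c d = lookup (x ∷ᵛ opp x ∷ᵛ a ∷ᵛ b ∷ᵛ c ∷ᵛ d ∷ᵛ []ᵛ)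

exactlyTwo? : {P : Vertex → Set} → (∀ v → Dec (P v)) → Dec (ExactlyTwo P)
exactlyTwo? P? = any? λ v₁ → any? λ v₂ → ¬? (v₁ ≟ v₂) ×-dec P? v₁ ×-dec P? v₂ ×-dec
  all? λ v → P? v →-dec ((v ≟ v₁) ⊎-dec (v ≟ v₂))

opaque
  axial-classification : ∀ x a b c d → (∀ f g → axial x a b c d f ≡ axial x a b c d g → f ≡ g) →
                         Classification InCoset₂₄ x (axial x a b c d)
  axial-classification = from-yes (all? λ x → all? λ a → all? λ b → all? λ c → all? λ d →
    let π = axial x a b c d in
    (all? λ f → all? λ g → (π f ≟ π g) →-dec (f ≟ g)) →-dec
    (inCoset₂₄? (λ f → f) π ⊎-dec inCoset₂₄? refl-x π ⊎-dec any? λ t → inCoset₂₄? (κ x t) π))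

  -- A reflection reverses every oriented corner.
  reflection-hits-nothing : ∀ v → ¬ CornerImage refl-x v
  reflection-hits-nothing = from-yes (all? λ v → ¬? (cornerImage? refl-x v))

  representative-hits-two : ∀ x t → ExactlyTwo (CornerImage (κ x t))
  representative-hits-two = from-yes (all? λ x → all? λ t → exactlyTwo? (cornerImage? (κ x t)))

  representatives-disjoint : ∀ x t t′ → ¬ t ≡ t′ →
                             ∀ v → CornerImage (κ x t) v → ¬ CornerImage (κ x t′) v
  representatives-disjoint = from-yes (all? λ x → all? λ t → all? λ t′ → ¬? (t ≟ t′) →-dec
    all? λ v → cornerImage? (κ x t) v →-dec ¬? (cornerImage? (κ x t′) v))

axis-classification : ∀ x (π : Relabelling) → Injective _≡_ _≡_ π → π 0F ≡ x → π 1F ≡ opp x →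
                      Classification InCoset x π
axis-classification x π π-inj e₀ e₁ =
  map-classification {InCoset₂₄} {InCoset} {x} (λ h → coset-trans (forget h) (coset [] π≈axial))
    (axial-classification x (π 2F) (π 3F) (π 4F) (π 5F)
       (λ f g e → π-inj (trans (π≈axial f) (trans e (sym (π≈axial g))))))
  where
  π≈axial : ∀ f → π f ≡ axial x (π 2F) (π 3F) (π 4F) (π 5F) f
  π≈axial 0F = e₀
  π≈axial 1F = e₁
  π≈axial 2F = refl
  π≈axial 3F = refl
  π≈axial 4F = refl
  π≈axial 5F = refl
  forget : ∀ {σ τ} → InCoset₂₄ σ τ → InCoset σ τ
  forget (y , s , e) = coset (rotation y s) e

-- An injective relabelling sending the axis through y onto the axis through x
-- is classified: precompose it with toward y.
classification : ∀ {x y} (π : Relabelling) → Injective _≡_ _≡_ π → π y ≡ x → π (opp y) ≡ opp x →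
                 Classification InCoset x π
classification {x} {y} π π-inj πy πy′ =
  map-classification {InCoset} {InCoset} {x}
    (λ h → coset-trans h (coset-sym (coset (toward y) λ f → refl)))
    (axis-classification x (π ∘ act (toward y)) (λ e → act-injective (toward y) (π-inj e))
       (trans (cong π (proj₁ (toward-axis y))) πy) (trans (cong π (proj₂ (toward-axis y))) πy′))

module Relative (c : Cube) where

  faceOf : Color → Face
  faceOf a = proj₁ (injective⇒surjective (col c) (col-inj c) a)

  col-faceOf : ∀ a → col c (faceOf a) ≡ a
  col-faceOf a = proj₂ (injective⇒surjective (col c) (col-inj c) a)

  faceOf-col : ∀ f → faceOf (col c f) ≡ f
  faceOf-col f = col-inj c (col-faceOf (col c f))

  position : Cube → Relabelling
  position d f = faceOf (col d f)

  col-position : ∀ d f → col d f ≡ col c (position d f)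
  col-position d f = sym (col-faceOf (col d f))

  position-injective : ∀ d → Injective _≡_ _≡_ (position d)
  position-injective d e =
    col-inj d (trans (col-position d _) (trans (cong (col c) e) (sym (col-position d _))))

  pair-classification : ∀ {a b} (hc : HasOppositePair c a b) d → HasOppositePair d a b →
                        Classification InCoset (axisOf {c} hc) (position d)
  pair-classification hc d hd =
    classification {axisOf {c} hc} {axisOf {d} hd} (position d) (position-injective d)
      (sends (proj₁ (proj₂ (oppositeFace {d} hd))) (proj₁ (proj₂ (oppositeFace {c} hc))))
      (sends (proj₂ (proj₂ (oppositeFace {d} hd))) (proj₂ (proj₂ (oppositeFace {c} hc))))
    where
    sends : ∀ {y x z} → col d y ≡ z → col c x ≡ z → position d y ≡ x
    sends {x = x} e e′ = trans (cong faceOf (trans e (sym e′))) (faceOf-col x)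

  other-class : ∀ {a b} (hc : HasOppositePair c a b) d → HasOppositePair d a b →
                ¬ SameVariety c d → ¬ SameVariety (mirror c) d →
                ∃[ t ] InCoset (κ (axisOf {c} hc) t) (position d)
  other-class hc d hd c≁d c*≁d with pair-classification hc d hd
  ... | inj₁ rot = ⊥-elim (c≁d (coset⇒sameVariety {c} {c} {d} (λ _ → refl) (col-position d) rot))
  ... | inj₂ (inj₁ ref) =
    ⊥-elim (c*≁d (coset⇒sameVariety {c} {mirror c} {d} (λ _ → refl) (col-position d) ref))
  ... | inj₂ (inj₂ class) = class

  shared-in-coset : ∀ {σ} d → InCoset σ (position d) → ∀ v →
                    (SharedAt c d v → CornerImage σ v) × (CornerImage σ v → SharedAt c d v)
  shared-in-coset d h v =
    coset-cornerImage h v ∘ proj₁ (shared⇔cornerImage {c} {d} (col-position d) v) ,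
    proj₂ (shared⇔cornerImage {c} {d} (col-position d) v) ∘ coset-cornerImage (coset-sym h) v

  class-exactly-two : ∀ x d → ∃[ t ] InCoset (κ x t) (position d) → ExactlyTwo (SharedAt c d)
  class-exactly-two x d (t , h) =
    exactlyTwo-transport (λ v → proj₂ (shared-in-coset d h v))
                         (λ v → proj₁ (shared-in-coset d h v))
      (representative-hits-two x t)

  classes-disjoint : ∀ x d e → ∃[ t ] InCoset (κ x t) (position d) →
                     ∃[ t′ ] InCoset (κ x t′) (position e) →
                     ¬ SameVariety d e → ∀ v → SharedAt c d v → ¬ SharedAt c e v
  classes-disjoint x d e (t , hd) (t′ , he) d≁e v sd se with t ≟ t′
  ... | yes refl =
    d≁e (coset⇒sameVariety {c} {d} {e} (col-position d) (col-position e)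
           (coset-trans (coset-sym hd) he))
  ... | no t≢t′ =
    representatives-disjoint x t t′ t≢t′ v
      (proj₁ (shared-in-coset d hd v) sd) (proj₁ (shared-in-coset e he v) se)

-- No cube shares a corner triple with its mirror image: c* = c ∘ refl-x.
mirror-shares-nothing : ∀ c → ¬ ShareSome c (mirror c)
mirror-shares-nothing c (v , s) =
  reflection-hits-nothing v (proj₁ (shared⇔cornerImage {c} {mirror c} (λ _ → refl) v) s)

lemma5p3 : (a b : Color) → ¬ a ≡ b → (c : Cube) → HasOppositePair c a b →
    ¬ ShareSome c (mirror c)
    × (∀ (d : Cube) → HasOppositePair d a b → ¬ SameVariety c d → ¬ SameVariety (mirror c) d →
         ExactlyTwo (SharedAt c d))
    × (∀ (d e : Cube) → HasOppositePair d a b → HasOppositePair e a b →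
         ¬ SameVariety c d → ¬ SameVariety (mirror c) d →
         ¬ SameVariety c e → ¬ SameVariety (mirror c) e →
         ¬ SameVariety d e →
         ∀ (v : Vertex) → SharedAt c d v → ¬ SharedAt c e v)
lemma5p3 a b _ c hc =
  mirror-shares-nothing c ,
  (λ d hd c≁d c*≁d → class-exactly-two x d (other-class hc d hd c≁d c*≁d)) ,
  (λ d e hd he c≁d c*≁d c≁e c*≁e →
     classes-disjoint x d e (other-class hc d hd c≁d c*≁d) (other-class hc e he c≁e c*≁e))
  where
  open Relative c
  x : Face
  x = axisOf {c} hc
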